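{- Let $G$ be a nice graph with $m$ edges and maximum degree $\Delta$. (1) If $x$ is the minimum label sum of a proper labelling of $G$, then $x \leq {\rm ML}^{\rm W}(G)+m \leq 3(m+\Delta x)$. (2) $\chi'_{\rm s}(G) \leq {\rm ME}^{\rm W}(G)+1 \leq 3(1+\Delta\chi'_{\rm s}(G))$. (3) If $x$ is the minimum vertex sum of a proper labelling of $G$, then $x \leq {\rm MV}^{\rm W}(G)+\Delta \leq 3\Delta(1+x)$.
   Context: All graphs are finite and simple; a graph is nice if it is connected and not isomorphic to $K_2$. A $k$-labelling of $G$ is a map $\ell:E(G)\to\{1,\dots,k\}$; a labelling is a $k$-labelling for some $k$. For a vertex $u$, $\sigma_\ell(u)=\sum_{v\in N(u)}\ell(uv)$. A labelling $\ell$ is proper if $\sigma_\ell(u)\neq\sigma_\ell(v)$ for every edge $uv$. $\chi'_{\rm s}(G)$ is the smallest $k$ such that $G$ has a proper $k$-labelling. The label sum of $\ell$ is $\sum_{e\in E(G)}\ell(e)$, and the vertex sum of $\ell$ is $\max_{u\in V(G)}\sigma_\ell(u)$; "minimum label sum (resp. vertex sum) of a proper labelling" means the minimum over all proper labellings. A walk of $G$ is a sequence of vertices in which consecutive vertices are adjacent (repetitions allowed); its length is its number of traversed edges with repetition. For a walk $W$, $G+W$ is the multigraph on $V(G)$ with edge multiset $E(G)$ plus every edge traversed by $W$, added as many times as traversed. A multigraph is locally irregular if no two adjacent vertices have equal degree; $W$ is irregularising if $G+W$ is locally irregular. ${\rm ML}^{\rm W}(G)$ is the minimum length of an irregularising walk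 of $G$; ${\rm ME}^{\rm W}(G)$ is the minimum, over irregularising walks $W$, of the maximum number of times an edge of $G$ is traversed by $W$; ${\rm MV}^{\rm W}(G)$ is the minimum, over irregularising walks $W$, of the maximum over vertices $v$ of the number of edge traversals of $W$ incident to $v$ (all these minima taken over nonnegative integers, and $+\infty$ if no irregularising walk exists). -}

module Defs where

open import Data.Nat using (ℕ; zero; suc; _+_; _*_; _∸_; _≤_; _<_; _⊔_)
open import Data.Nat.Properties using (_<?_)
open import Data.Fin using (Fin; toℕ) renaming (zero to fzero; suc to fsuc)
open import Data.Fin.Properties using () renaming (_≟_ to _≟F_)
open import Data.Bool using (Bool; true; false; _∧_; _∨_; if_then_else_)
open import Data.List using (List; []; _∷_; length)
open import Data.Product using (Σ; _×_; _,_; ∃)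
open import Relation.Binary.PropositionalEquality using (_≡_; _≢_)
open import Relation.Nullary.Decidable using (⌊_⌋)
open import Data.Empty using (⊥)

Σ[_] : (n : ℕ) → (Fin n → ℕ) → ℕ
Σ[ zero ] f = 0
Σ[ suc n ] f = f fzero + Σ[ n ] (λ i → f (fsuc i))

Max[_] : (n : ℕ) → (Fin n → ℕ) → ℕ
Max[ zero ] f = 0
Max[ suc n ] f = f fzero ⊔ Max[ n ] (λ i → f (fsuc i))

record Graph : Set where
  field
    n     : ℕ
    adj   : Fin n → Fin n → Bool
    sym   : ∀ u v → adj u v ≡ adj v u
    irref : ∀ u → adj u u ≡ false
open Graph public

[_] : Bool → ℕ
[ true ] = 1
[ false ] = 0

IsWalk : (G : Graph) → List (Fin (n G)) → Set
IsWalk G [] = ⊤′ where open import Data.Unit using () renaming (⊤ to ⊤′)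
IsWalk G (a ∷ []) = ⊤′ where open import Data.Unit using () renaming (⊤ to ⊤′)
IsWalk G (a ∷ b ∷ w) = (adj G a b ≡ true) × IsWalk G (b ∷ w)

WalkFromTo : (G : Graph) → Fin (n G) → Fin (n G) → List (Fin (n G)) → Set
WalkFromTo G u v [] = ⊥
WalkFromTo G u v (a ∷ w) = (a ≡ u) × (lastOf a w ≡ v) × IsWalk G (a ∷ w)
  where
  lastOf : Fin (n G) → List (Fin (n G)) → Fin (n G)
  lastOf x [] = x
  lastOf x (y ∷ ys) = lastOf y ys

Connected : Graph → Set
Connected G = (1 ≤ n G) × (∀ u v → ∃ λ w → WalkFromTo G u v w)

-- G is isomorphic to K2 iff it has exactly 2 vertices and they are adjacent
IsK2 : Graph → Set
IsK2 G = Σ (n G ≡ 2) λ { refl → adj G fzero (fsuc fzero) ≡ true }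
  where open import Relation.Binary.PropositionalEquality using (refl)

Nice : Graph → Set
Nice G = Connected G × (IsK2 G → ⊥)

module _ (G : Graph) where
  private
    N = n G
    A = adj G

  deg : Fin N → ℕ
  deg u = Σ[ N ] (λ v → [ A u v ])

  edges : ℕ
  edges = Σ[ N ] (λ u → Σ[ N ] (λ v → [ A u v ∧ ⌊ toℕ u <? toℕ v ⌋ ]))

  Δ : ℕ
  Δ = Max[ N ] deg

  -- Labellings: ℓ u v is the label of edge uv (values off edges are irrelevant)
  IsLabelling : (Fin N → Fin N → ℕ) → Set
  IsLabelling ℓ = ∀ u v → A u v ≡ true → (1 ≤ ℓ u v) × (ℓ u v ≡ ℓ v u)

  IsKLabelling : ℕ → (Fin N → Fin N → ℕ) → Set
  IsKLabelling k ℓ = IsLabelling ℓ × (∀ u v → A u v ≡ true → ℓ u v ≤ k)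

  σ : (Fin N → Fin N → ℕ) → Fin N → ℕ
  σ ℓ u = Σ[ N ] (λ v → if A u v then ℓ u v else 0)

  IsProper : (Fin N → Fin N → ℕ) → Set
  IsProper ℓ = ∀ u v → A u v ≡ true → σ ℓ u ≢ σ ℓ v

  labelSum : (Fin N → Fin N → ℕ) → ℕ
  labelSum ℓ = Σ[ N ] (λ u → Σ[ N ] (λ v →
                 if A u v ∧ ⌊ toℕ u <? toℕ v ⌋ then ℓ u v else 0))

  vertexSum : (Fin N → Fin N → ℕ) → ℕ
  vertexSum ℓ = Max[ N ] (σ ℓ)

  trav : List (Fin N) → Fin N → Fin N → ℕ
  trav [] u v = 0
  trav (a ∷ []) u v = 0
  trav (a ∷ b ∷ w) u v =
    [ (⌊ a ≟F u ⌋ ∧ ⌊ b ≟F v ⌋) ∨ (⌊ a ≟F v ⌋ ∧ ⌊ b ≟F u ⌋) ] + trav (b ∷ w) u v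

  walkLength : List (Fin N) → ℕ
  walkLength w = length w ∸ 1

  incident : List (Fin N) → Fin N → ℕ
  incident w u = Σ[ N ] (λ v → if A u v then trav w u v else 0)

  -- degree of u in the multigraph G + w
  degPlus : List (Fin N) → Fin N → ℕ
  degPlus w u = deg u + incident w u

  IsIrregularising : List (Fin N) → Set
  IsIrregularising w = IsWalk G w × (∀ u v → A u v ≡ true → degPlus w u ≢ degPlus w v)

  maxEdgeTrav : List (Fin N) → ℕ
  maxEdgeTrav w = Max[ N ] (λ u → Max[ N ] (λ v → if A u v then trav w u v else 0))

  maxVertexTrav : List (Fin N) → ℕ
  maxVertexTrav w = Max[ N ] (incident w)

IsMin : (ℕ → Set) → ℕ → Set
IsMin P x = P x × (∀ y → P y → x ≤ y)

module _ (G : Graph) where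
  private N = n G

  IsMinLabelSum : ℕ → Set
  IsMinLabelSum = IsMin (λ s → ∃ λ (ℓ : Fin N → Fin N → ℕ) →
                    IsLabelling G ℓ × IsProper G ℓ × labelSum G ℓ ≡ s)

  IsMinVertexSum : ℕ → Set
  IsMinVertexSum = IsMin (λ s → ∃ λ (ℓ : Fin N → Fin N → ℕ) →
                    IsLabelling G ℓ × IsProper G ℓ × vertexSum G ℓ ≡ s)

  IsChiS : ℕ → Set
  IsChiS = IsMin (λ k → ∃ λ (ℓ : Fin N → Fin N → ℕ) → IsKLabelling G k ℓ × IsProper G ℓ)

  -- ML^W(G) = L  (finite value)
  IsMLW : ℕ → Set
  IsMLW = IsMin (λ L → ∃ λ w → IsIrregularising G w × walkLength G w ≡ L)

  IsMEW : ℕ → Set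
  IsMEW = IsMin (λ L → ∃ λ w → IsIrregularising G w × maxEdgeTrav G w ≡ L)

  IsMVW : ℕ → Set
  IsMVW = IsMin (λ L → ∃ λ w → IsIrregularising G w × maxVertexTrav G w ≡ L)

-- An irregularising walk w yields the proper labelling uv ↦ 1 + (number of traversals of uv by
-- w), whose vertex sums are the degrees of G + w.  Its label sum is m + |w|, its labels are at
-- most ME(w) + 1 and its vertex sums at most Δ + MV(w); this gives the lower bounds.
-- Conversely, a proper labelling ℓ gives a walk W traversing every edge uv exactly 2Δ·ℓ(uv)
-- times: go around a spanning tree (each tree edge twice) and insert back-and-forth detours
-- u → v → u.  In G + W the degree of u is deg u + 2Δ·σ_ℓ(u) with deg u < 2Δ, so W is
-- irregularising because ℓ is proper, and its length and its maximal edge and vertex traversals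
-- are 2Δ times the label sum, the largest label and the vertex sum of ℓ; this gives the upper
-- bounds.

module Submission where

import Data.Bool as Bool
open import Data.Bool using (Bool; true; false; _∧_; _∨_; if_then_else_)
open import Data.Bool.Properties using (if-eta; ∧-comm; ∨-comm; ∧-zeroʳ; ∧-identityʳ; ∨-identityʳ)
open import Data.Empty using (⊥-elim)
open import Data.Fin using (Fin; toℕ; fromℕ<; zero; suc)
open import Data.Fin.Properties using (any?; all?; toℕ-injective) renaming (_≟_ to _≟F_)
open import Data.List using (List; []; _∷_; length; allFin)
open import Data.List.Membership.Propositional using (_∈_; _∉_)
open import Data.List.Membership.Propositional.Properties using (∈-allFin)
open import Data.List.Relation.Binary.Subset.Propositional using (_⊆_)
open import Data.List.Relation.Binary.Subset.Propositional.Properties using (⊆-refl; ⊆-trans; ∈-∷⁺ʳ)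
open import Data.List.Relation.Unary.Any using (here; there)
open import Data.Nat using (ℕ; zero; suc; _+_; _*_; _∸_; _≤_; _<_; z≤n; s≤s; NonZero; >-nonZero)
open import Data.Nat.DivMod using (_/_; _%_; [m+kn]%n≡m%n; m<n⇒m%n≡m)
open import Data.Nat.Properties
open import Algebra.Properties.CommutativeSemigroup +-commutativeSemigroup
  using (interchange; x∙yz≈y∙xz)
open import Data.Product using (∃; _×_; _,_; proj₁; proj₂)
open import Data.Sum using (_⊎_; inj₁; inj₂)
open import Function using (id; _∘_)
open import Relation.Binary.PropositionalEquality hiding ([_])
open import Relation.Nullary using (Dec; yes; no; ¬_; contradiction)
open import Relation.Nullary.Decidable using (⌊_⌋; ⌊⌋-map′; map′; _⊎-dec_; _×-dec_; _→-dec_; ¬?)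
open import Relation.Unary using (Decidable)

open import Defs renaming (sym to adj-sym)

Σ-cong : ∀ k {f g : Fin k → ℕ} → (∀ i → f i ≡ g i) → Σ[ k ] f ≡ Σ[ k ] g
Σ-cong zero    f≡g = refl
Σ-cong (suc k) f≡g = cong₂ _+_ (f≡g zero) (Σ-cong k (f≡g ∘ suc))

Σ-mono-≤ : ∀ k {f g : Fin k → ℕ} → (∀ i → f i ≤ g i) → Σ[ k ] f ≤ Σ[ k ] g
Σ-mono-≤ zero    f≤g = z≤n
Σ-mono-≤ (suc k) f≤g = +-mono-≤ (f≤g zero) (Σ-mono-≤ k (f≤g ∘ suc))

Σ-distrib-+ : ∀ k (f g : Fin k → ℕ) → Σ[ k ] (λ i → f i + g i) ≡ Σ[ k ] f + Σ[ k ] g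
Σ-distrib-+ zero    f g = refl
Σ-distrib-+ (suc k) f g = begin
  f zero + g zero + Σ[ k ] (λ i → f (suc i) + g (suc i))
    ≡⟨ cong (f zero + g zero +_) (Σ-distrib-+ k (f ∘ suc) (g ∘ suc)) ⟩
  f zero + g zero + (Σ[ k ] (f ∘ suc) + Σ[ k ] (g ∘ suc))
    ≡⟨ interchange (f zero) (g zero) _ _ ⟩
  f zero + Σ[ k ] (f ∘ suc) + (g zero + Σ[ k ] (g ∘ suc))
    ∎
  where open ≡-Reasoning

Σ²-distrib-+ : ∀ k (f g : Fin k → Fin k → ℕ) →
               Σ[ k ] (λ u → Σ[ k ] (λ v → f u v + g u v))
               ≡ Σ[ k ] (λ u → Σ[ k ] (f u)) + Σ[ k ] (λ u → Σ[ k ] (g u))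
Σ²-distrib-+ k f g = trans (Σ-cong k (λ u → Σ-distrib-+ k (f u) (g u))) (Σ-distrib-+ k _ _)

*-distribˡ-Σ : ∀ k c (f : Fin k → ℕ) → c * Σ[ k ] f ≡ Σ[ k ] (λ i → c * f i)
*-distribˡ-Σ zero    c f = *-zeroʳ c
*-distribˡ-Σ (suc k) c f =
  trans (*-distribˡ-+ c (f zero) _) (cong (c * f zero +_) (*-distribˡ-Σ k c (f ∘ suc)))

Σ-const : ∀ k c → Σ[ k ] (λ _ → c) ≡ k * c
Σ-const zero    c = refl
Σ-const (suc k) c = cong (c +_) (Σ-const k c)

term≤Σ : ∀ k (f : Fin k → ℕ) i → f i ≤ Σ[ k ] f
term≤Σ (suc k) f zero    = m≤m+n _ _
term≤Σ (suc k) f (suc i) = ≤-trans (term≤Σ k (f ∘ suc) i) (m≤n+m _ _)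

Σ-zero : ∀ k → Σ[ k ] (λ _ → 0) ≡ 0
Σ-zero k = trans (Σ-const k 0) (*-zeroʳ k)

Σ-select : ∀ k (f : Fin k → ℕ) j → Σ[ k ] (λ i → [ ⌊ j ≟F i ⌋ ] * f i) ≡ f j
Σ-select (suc k) f zero    =
  trans (cong₂ _+_ (+-identityʳ (f zero)) (Σ-zero k)) (+-identityʳ (f zero))
Σ-select (suc k) f (suc j) = trans
  (Σ-cong k (λ i → cong (λ b → [ b ] * f (suc i)) (⌊⌋-map′ _ _ (j ≟F i))))
  (Σ-select k (f ∘ suc) j)

term≤Max : ∀ k (f : Fin k → ℕ) i → f i ≤ Max[ k ] f
term≤Max (suc k) f zero    = m≤m⊔n _ _
term≤Max (suc k) f (suc i) = ≤-trans (term≤Max k (f ∘ suc) i) (m≤n⊔m _ _)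

Max-lub : ∀ k (f : Fin k → ℕ) {b} → (∀ i → f i ≤ b) → Max[ k ] f ≤ b
Max-lub zero    f f≤b = z≤n
Max-lub (suc k) f f≤b = ⊔-lub (f≤b zero) (Max-lub k (f ∘ suc) (f≤b ∘ suc))

*-[∧] : ∀ p q x → x * [ p ∧ q ] ≡ [ p ] * ([ q ] * x)
*-[∧] true  q x = trans (*-comm x [ q ]) (sym (*-identityˡ ([ q ] * x)))
*-[∧] false q x = *-zeroʳ x

Σ²-select : ∀ k (h : Fin k → Fin k → ℕ) a b →
            Σ[ k ] (λ u → Σ[ k ] (λ v → h u v * [ ⌊ a ≟F u ⌋ ∧ ⌊ b ≟F v ⌋ ])) ≡ h a b
Σ²-select k h a b = begin
  Σ[ k ] (λ u → Σ[ k ] (λ v → h u v * [ ⌊ a ≟F u ⌋ ∧ ⌊ b ≟F v ⌋ ]))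
    ≡⟨ Σ-cong k (λ u → Σ-cong k (λ v → *-[∧] ⌊ a ≟F u ⌋ ⌊ b ≟F v ⌋ (h u v))) ⟩
  Σ[ k ] (λ u → Σ[ k ] (λ v → [ ⌊ a ≟F u ⌋ ] * ([ ⌊ b ≟F v ⌋ ] * h u v)))
    ≡⟨ Σ-cong k (λ u → *-distribˡ-Σ k [ ⌊ a ≟F u ⌋ ] _) ⟨
  Σ[ k ] (λ u → [ ⌊ a ≟F u ⌋ ] * Σ[ k ] (λ v → [ ⌊ b ≟F v ⌋ ] * h u v))
    ≡⟨ Σ-select k _ a ⟩
  Σ[ k ] (λ v → [ ⌊ b ≟F v ⌋ ] * h a v)
    ≡⟨ Σ-select k (h a) b ⟩
  h a b
    ∎
  where open ≡-Reasoning

-- The summand of trav: trav G (a ∷ b ∷ w) u v reduces to δ a b u v + trav G (b ∷ w) u v.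
δ : ∀ {k} → Fin k → Fin k → Fin k → Fin k → ℕ
δ a b u v = [ (⌊ a ≟F u ⌋ ∧ ⌊ b ≟F v ⌋) ∨ (⌊ a ≟F v ⌋ ∧ ⌊ b ≟F u ⌋) ]

δ-split : ∀ {k} {a b : Fin k} → a ≢ b → ∀ u v →
          δ a b u v ≡ [ ⌊ a ≟F u ⌋ ∧ ⌊ b ≟F v ⌋ ] + [ ⌊ b ≟F u ⌋ ∧ ⌊ a ≟F v ⌋ ]
δ-split {a = a} {b} a≢b u v with a ≟F u | b ≟F u
... | yes refl | yes refl = ⊥-elim (a≢b refl)
... | yes _    | no _     rewrite ∧-zeroʳ ⌊ a ≟F v ⌋ | ∨-identityʳ ⌊ b ≟F v ⌋ = sym (+-identityʳ _)
... | no _     | yes _    rewrite ∧-identityʳ ⌊ a ≟F v ⌋ = refl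
... | no _     | no _     rewrite ∧-zeroʳ ⌊ a ≟F v ⌋ = refl

Σ²-δ : ∀ k (h : Fin k → Fin k → ℕ) {a b} → a ≢ b →
       Σ[ k ] (λ u → Σ[ k ] (λ v → h u v * δ a b u v)) ≡ h a b + h b a
Σ²-δ k h {a} {b} a≢b = begin
  Σ[ k ] (λ u → Σ[ k ] (λ v → h u v * δ a b u v))
    ≡⟨ Σ-cong k (λ u → Σ-cong k (λ v → cong (h u v *_) (δ-split a≢b u v))) ⟩
  Σ[ k ] (λ u → Σ[ k ] (λ v → h u v * ([ ⌊ a ≟F u ⌋ ∧ ⌊ b ≟F v ⌋ ] + [ ⌊ b ≟F u ⌋ ∧ ⌊ a ≟F v ⌋ ])))
    ≡⟨ Σ-cong k (λ u → Σ-cong k (λ v → *-distribˡ-+ (h u v) _ _)) ⟩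
  Σ[ k ] (λ u → Σ[ k ] (λ v → h u v * [ ⌊ a ≟F u ⌋ ∧ ⌊ b ≟F v ⌋ ]
                             + h u v * [ ⌊ b ≟F u ⌋ ∧ ⌊ a ≟F v ⌋ ]))
    ≡⟨ Σ²-distrib-+ k _ _ ⟩
  Σ[ k ] (λ u → Σ[ k ] (λ v → h u v * [ ⌊ a ≟F u ⌋ ∧ ⌊ b ≟F v ⌋ ]))
    + Σ[ k ] (λ u → Σ[ k ] (λ v → h u v * [ ⌊ b ≟F u ⌋ ∧ ⌊ a ≟F v ⌋ ]))
    ≡⟨ cong₂ _+_ (Σ²-select k h a b) (Σ²-select k h b a) ⟩
  h a b + h b a
    ∎
  where open ≡-Reasoning

≟F-sym : ∀ {k} (a b : Fin k) → ⌊ a ≟F b ⌋ ≡ ⌊ b ≟F a ⌋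
≟F-sym a b with a ≟F b | b ≟F a
... | yes _    | yes _    = refl
... | no _     | no _     = refl
... | yes refl | no b≢a   = ⊥-elim (b≢a refl)
... | no a≢b   | yes refl = ⊥-elim (a≢b refl)

δ-symʳ : ∀ {k} (a b u v : Fin k) → δ a b u v ≡ δ a b v u
δ-symʳ a b u v = cong [_] (∨-comm (⌊ a ≟F u ⌋ ∧ ⌊ b ≟F v ⌋) _)

δ-symˡ : ∀ {k} (a b u v : Fin k) → δ a b u v ≡ δ b a u v
δ-symˡ a b u v = cong [_] (trans (∨-comm (⌊ a ≟F u ⌋ ∧ ⌊ b ≟F v ⌋) _)
  (cong₂ _∨_ (∧-comm ⌊ a ≟F v ⌋ _) (∧-comm ⌊ a ≟F u ⌋ _)))

δ-comm : ∀ {k} (a b u v : Fin k) → δ a b u v ≡ δ u v a b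
δ-comm a b u v rewrite ≟F-sym u a | ≟F-sym v b | ≟F-sym u b | ≟F-sym v a =
  cong (λ c → [ (⌊ a ≟F u ⌋ ∧ ⌊ b ≟F v ⌋) ∨ c ]) (∧-comm ⌊ a ≟F v ⌋ _)

[]≤1 : ∀ b → [ b ] ≤ 1
[]≤1 true  = s≤s z≤n
[]≤1 false = z≤n

δ-outside : ∀ {k} {a b u : Fin k} → a ≢ u → b ≢ u → ∀ v → δ a b u v ≡ 0
δ-outside {a = a} {b} {u} a≢u b≢u v with a ≟F u | b ≟F u
... | yes a≡u | _       = ⊥-elim (a≢u a≡u)
... | no _    | yes b≡u = ⊥-elim (b≢u b≡u)
... | no _    | no _    = cong [_] (∧-zeroʳ ⌊ a ≟F v ⌋)

if-suc : ∀ b t → (if b then suc t else 0) ≡ [ b ] + (if b then t else 0)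
if-suc true  t = refl
if-suc false t = refl

if-+ : ∀ b x y → (if b then x + y else 0) ≡ (if b then x else 0) + (if b then y else 0)
if-+ true  x y = refl
if-+ false x y = refl

if-1* : ∀ b x → (if b then 1 else 0) * x ≡ (if b then x else 0)
if-1* true  x = +-identityʳ x
if-1* false x = refl

if-* : ∀ b {x y} k → (b ≡ true → x ≡ k * y) → (if b then x else 0) ≡ k * (if b then y else 0)
if-* true  k x≡ky = x≡ky refl
if-* false k x≡ky = sym (*-zeroʳ k)

if-≤ : ∀ b {x y} → (b ≡ true → x ≤ y) → (if b then x else 0) ≤ y
if-≤ true  x≤y = x≤y refl
if-≤ false x≤y = z≤n

∧-trueˡ : ∀ a {b} → a ∧ b ≡ true → a ≡ true
∧-trueˡ true _ = refl

module _ {P : ℕ → Set} (P? : Decidable P) where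

  private
    searchFrom : ∀ k → (∀ {j} → j < k → ¬ P j) → ∀ d → P (d + k) → ∃ (IsMin P)
    searchFrom k below d Pd+k with P? k
    ... | yes Pk = k , Pk , λ j Pj → ≮⇒≥ (λ j<k → below j<k Pj)
    searchFrom k below zero    Pk   | no ¬Pk = contradiction Pk ¬Pk
    searchFrom k below (suc d) Pd+k | no ¬Pk =
      searchFrom (suc k) below′ d (subst P (sym (+-suc d k)) Pd+k)
      where
      below′ : ∀ {j} → j < suc k → ¬ P j
      below′ j<1+k with m<1+n⇒m<n∨m≡n j<1+k
      ... | inj₁ j<k  = below j<k
      ... | inj₂ refl = ¬Pk

  minimum : ∀ {x} → P x → ∃ (IsMin P)
  minimum {x} Px = searchFrom 0 (λ ()) x (subst P (sym (+-identityʳ x)) Px)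

∃-bounded? : ∀ {m} {P : List (Fin m) → Set} → (∀ w → Dec (P w)) →
             ∀ K → Dec (∃ λ w → length w ≤ K × P w)
∃-bounded? P? zero = map′ (λ P[] → [] , z≤n , P[]) (λ { ([] , _ , P[]) → P[] }) (P? [])
∃-bounded? P? (suc K) = map′
  (λ { (inj₁ P[]) → [] , z≤n , P[] ; (inj₂ (a , w , ∣w∣≤K , Pa∷w)) → a ∷ w , s≤s ∣w∣≤K , Pa∷w })
  (λ { ([] , _ , P[]) → inj₁ P[] ; (a ∷ w , s≤s ∣w∣≤K , Pa∷w) → inj₂ (a , w , ∣w∣≤K , Pa∷w) })
  (P? [] ⊎-dec any? (λ a → ∃-bounded? (λ w → P? (a ∷ w)) K))

quotient-unique : ∀ {a b c p q} → a < c → b < c → a + c * p ≡ b + c * q → p ≡ q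
quotient-unique {a} {b} {c} {p} {q} a<c b<c eq =
  *-cancelˡ-≡ p q c (+-cancelˡ-≡ b _ _ (trans (cong (_+ c * p) (sym a≡b)) eq))
  where
  instance
    c≢0 : NonZero c
    c≢0 = >-nonZero (m<n⇒0<n a<c)

  remainder : ∀ {r k} → r < c → (r + c * k) % c ≡ r
  remainder {r} {k} r<c = begin
    (r + c * k) % c ≡⟨ cong (λ t → (r + t) % c) (*-comm c k) ⟩
    (r + k * c) % c ≡⟨ [m+kn]%n≡m%n r k c ⟩
    r % c           ≡⟨ m<n⇒m%n≡m r<c ⟩
    r               ∎
    where open ≡-Reasoning

  a≡b : a ≡ b
  a≡b = trans (sym (remainder a<c)) (trans (cong (_% c) eq) (remainder b<c))

m≤2n⇒m+o≤3[o+n] : ∀ {m n} o → m ≤ 2 * n → m + o ≤ 3 * (o + n)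
m≤2n⇒m+o≤3[o+n] {m} {n} o m≤2n = begin
  m + o         ≤⟨ +-mono-≤ (≤-trans m≤2n (*-monoˡ-≤ n (n≤1+n 2))) (m≤n*m o 3) ⟩
  3 * n + 3 * o ≡⟨ +-comm (3 * n) _ ⟩
  3 * o + 3 * n ≡⟨ *-distribˡ-+ 3 o n ⟨
  3 * (o + n)   ∎
  where open ≤-Reasoning

2[m∸t/2]+t≡2m : ∀ {m t} → 1 ≤ m → t ≡ 0 ⊎ t ≡ 2 → 2 * (m ∸ t / 2) + t ≡ 2 * m
2[m∸t/2]+t≡2m {m}     _         (inj₁ refl) = +-identityʳ (2 * m)
2[m∸t/2]+t≡2m {suc m} (s≤s z≤n) (inj₂ refl) = trans (+-comm (2 * m) 2) (sym (*-suc 2 m))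

module _ (G : Graph) where

  private
    N = n G
    A = adj G

  open import Data.List.Membership.DecPropositional (_≟F_ {N}) using (_∈?_)

  trav-sym : ∀ w u v → trav G w u v ≡ trav G w v u
  trav-sym []          u v = refl
  trav-sym (a ∷ [])    u v = refl
  trav-sym (a ∷ b ∷ w) u v = cong₂ _+_ (δ-symʳ a b u v) (trav-sym (b ∷ w) u v)

  ∉⇒trav≡0 : ∀ {u} w → u ∉ w → ∀ v → trav G w u v ≡ 0
  ∉⇒trav≡0 []          u∉w v = refl
  ∉⇒trav≡0 (a ∷ [])    u∉w v = refl
  ∉⇒trav≡0 {u} (a ∷ b ∷ w) u∉w v = cong₂ _+_
    (δ-outside {a = a} {b} {u} (λ { refl → u∉w (here refl) }) (λ { refl → u∉w (there (here refl)) })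
               v)
    (∉⇒trav≡0 (b ∷ w) (u∉w ∘ there) v)

  adj⇒≢ : ∀ {a b} → A a b ≡ true → a ≢ b
  adj⇒≢ {a} e refl with () ← trans (sym e) (irref G a)

  -- The orientation toℕ u < toℕ v in which edges and labelSum count each edge once.
  oriented : Fin N → Fin N → Bool
  oriented u v = A u v ∧ ⌊ toℕ u <? toℕ v ⌋

  oriented-pair : ∀ {x y} → A x y ≡ true → ∀ k →
                  (if oriented x y then k else 0) + (if oriented y x then k else 0) ≡ k
  oriented-pair {x} {y} e k
    rewrite e | trans (adj-sym G y x) e with toℕ x <? toℕ y | toℕ y <? toℕ x
  ... | yes x<y | yes y<x = contradiction x<y (<-asym y<x)
  ... | yes _   | no _    = +-identityʳ k
  ... | no _    | yes _   = refl
  ... | no x≮y  | no y≮x  = contradiction (toℕ-injective (≤-antisym (≮⇒≥ y≮x) (≮⇒≥ x≮y))) (adj⇒≢ e)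

  totalTrav : List (Fin N) → ℕ
  totalTrav w = Σ[ N ] (λ u → Σ[ N ] (λ v → if oriented u v then trav G w u v else 0))

  private
    totalTrav-silent : Σ[ N ] (λ u → Σ[ N ] (λ v → if oriented u v then 0 else 0)) ≡ 0
    totalTrav-silent =
      trans (Σ-cong N (λ u → trans (Σ-cong N (λ v → if-eta (oriented u v))) (Σ-zero N))) (Σ-zero N)

  walkLength≡totalTrav : ∀ w → IsWalk G w → walkLength G w ≡ totalTrav w
  walkLength≡totalTrav []          _ = sym totalTrav-silent
  walkLength≡totalTrav (a ∷ [])    _ = sym totalTrav-silent
  walkLength≡totalTrav (a ∷ b ∷ w) (ab , b∷w-walk) = sym (begin
    Σ[ N ] (λ u → Σ[ N ] (λ v → if oriented u v then δ a b u v + trav G (b ∷ w) u v else 0))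
      ≡⟨ Σ-cong N (λ u → Σ-cong N (λ v → if-+ (oriented u v) (δ a b u v) _)) ⟩
    Σ[ N ] (λ u → Σ[ N ] (λ v → (if oriented u v then δ a b u v else 0)
                                + (if oriented u v then trav G (b ∷ w) u v else 0)))
      ≡⟨ Σ²-distrib-+ N _ _ ⟩
    Σ[ N ] (λ u → Σ[ N ] (λ v → if oriented u v then δ a b u v else 0)) + totalTrav (b ∷ w)
      ≡⟨ cong (_+ totalTrav (b ∷ w)) (Σ-cong N (λ u → Σ-cong N (λ v → if-1* (oriented u v) _))) ⟨
    Σ[ N ] (λ u → Σ[ N ] (λ v → (if oriented u v then 1 else 0) * δ a b u v)) + totalTrav (b ∷ w)
      ≡⟨ cong₂ _+_ (Σ²-δ N (λ u v → if oriented u v then 1 else 0) (adj⇒≢ ab))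
                   (sym (walkLength≡totalTrav (b ∷ w) b∷w-walk)) ⟩
    (if oriented a b then 1 else 0) + (if oriented b a then 1 else 0) + walkLength G (b ∷ w)
      ≡⟨ cong (_+ walkLength G (b ∷ w)) (oriented-pair ab 1) ⟩
    1 + walkLength G (b ∷ w)
      ∎)
    where open ≡-Reasoning

  -- Detours and doubled spanning trees

  -- Split in two so that detour u v (a ∷ w) reduces to a ∷ _ without deciding a ≟F u.
  detour : Fin N → Fin N → List (Fin N) → List (Fin N)
  detourAfter : Fin N → Fin N → Fin N → List (Fin N) → List (Fin N)

  detour u v []      = []
  detour u v (a ∷ w) = a ∷ detourAfter u v a w

  detourAfter u v a w with a ≟F u
  ... | yes _ = v ∷ a ∷ w
  ... | no _  = detour u v w

  trav-detour : ∀ {u} v w → u ∈ w → ∀ x y → trav G (detour u v w) x y ≡ 2 * δ u v x y + trav G w x y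
  trav-detour {u} v (a ∷ w) u∈a∷w x y with a ≟F u
  trav-detour v (a ∷ w) _ x y | yes refl = begin
    δ a v x y + (δ v a x y + trav G (a ∷ w) x y)
      ≡⟨ cong (λ d → δ a v x y + (d + _)) (δ-symˡ v a x y) ⟩
    δ a v x y + (δ a v x y + trav G (a ∷ w) x y)
      ≡⟨ +-assoc (δ a v x y) _ _ ⟨
    δ a v x y + δ a v x y + trav G (a ∷ w) x y
      ≡⟨ cong (λ d → δ a v x y + d + _) (+-identityʳ _) ⟨
    2 * δ a v x y + trav G (a ∷ w) x y
      ∎
    where open ≡-Reasoning
  trav-detour v (a ∷ w)     (here refl) x y | no a≢a = contradiction refl a≢a
  trav-detour {u} v (a ∷ b ∷ w) (there u∈) x y | no _ = begin
    δ a b x y + trav G (detour u v (b ∷ w)) x y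
      ≡⟨ cong (δ a b x y +_) (trav-detour v (b ∷ w) u∈ x y) ⟩
    δ a b x y + (2 * δ u v x y + trav G (b ∷ w) x y)
      ≡⟨ x∙yz≈y∙xz (δ a b x y) (2 * δ u v x y) _ ⟩
    2 * δ u v x y + trav G (a ∷ b ∷ w) x y
      ∎
    where open ≡-Reasoning

  detour-walk : ∀ {u v} w → A u v ≡ true → u ∈ w → IsWalk G w → IsWalk G (detour u v w)
  detour-walk {u} (a ∷ w) uv u∈a∷w a∷w-walk with a ≟F u
  detour-walk {v = v} (a ∷ w) uv _ a∷w-walk | yes refl = uv , trans (adj-sym G v a) uv , a∷w-walk
  detour-walk (a ∷ w)     uv (here refl) _           | no a≢a = contradiction refl a≢a
  detour-walk (a ∷ b ∷ w) uv (there u∈)  (ab , walk) | no _   = ab , detour-walk (b ∷ w) uv u∈ walk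

  ⊆-detour : ∀ {u v} w → w ⊆ detour u v w
  ⊆-detour {u} (a ∷ w) {x} x∈a∷w with a ≟F u | x∈a∷w
  ... | yes _ | here x≡a  = here x≡a
  ... | yes _ | there x∈w = there (there (there x∈w))
  ... | no _  | here x≡a  = here x≡a
  ... | no _  | there x∈w = there (⊆-detour w x∈w)

  ∈-detour : ∀ {u v} w → u ∈ w → v ∈ detour u v w
  ∈-detour {u} (a ∷ w) u∈a∷w with a ≟F u
  ∈-detour (a ∷ w) _ | yes refl = there (here refl)
  ∈-detour (a ∷ w) (here refl) | no a≢a = contradiction refl a≢a
  ∈-detour (a ∷ w) (there u∈w) | no _   = there (∈-detour w u∈w)

  TwiceOrNever : List (Fin N) → Set
  TwiceOrNever W = IsWalk G W × (∀ x y → trav G W x y ≡ 0 ⊎ trav G W x y ≡ 2)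

  detour-twiceOrNever : ∀ {a b W} → A a b ≡ true → a ∈ W → b ∉ W →
                        TwiceOrNever W → TwiceOrNever (detour a b W)
  detour-twiceOrNever {a} {b} {W} ab a∈W b∉W (walk , W-trav) =
    detour-walk W ab a∈W walk ,
    λ x y → subst (λ t → t ≡ 0 ⊎ t ≡ 2) (sym (trav-detour b W a∈W x y)) (added x y)
    where
    fresh : ∀ d {t} → d ≤ 1 → t ≡ 0 → 2 * d + t ≡ 0 ⊎ 2 * d + t ≡ 2
    fresh zero    _         refl = inj₁ refl
    fresh (suc _) (s≤s z≤n) refl = inj₂ refl

    added : ∀ x y → 2 * δ a b x y + trav G W x y ≡ 0 ⊎ 2 * δ a b x y + trav G W x y ≡ 2
    added x y with x ≟F b | y ≟F b
    ... | yes refl | _        = fresh (δ a b b y) ([]≤1 _) (∉⇒trav≡0 W b∉W y)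
    ... | no _     | yes refl =
      fresh (δ a b x b) ([]≤1 _) (trans (trav-sym W x b) (∉⇒trav≡0 W b∉W x))
    ... | no x≢b   | no y≢b
      rewrite δ-comm a b x y | δ-symʳ x y a b | δ-outside x≢b y≢b a = W-trav x y

  -- Each vertex b of the path not yet on W is attached by the detour a → b → a, traversing the
  -- fresh edge ab exactly twice.
  absorb : ∀ {W} → TwiceOrNever W → ∀ {a} ps → a ∈ W → IsWalk G (a ∷ ps) →
           ∃ λ W′ → TwiceOrNever W′ × W ⊆ W′ × (a ∷ ps) ⊆ W′
  absorb tw []       a∈W _ = _ , tw , id , λ { (here refl) → a∈W }
  absorb {W} tw (b ∷ ps) a∈W (ab , walk) with b ∈? W
  ... | yes b∈W =
    let (W′ , tw′ , W⊆W′ , b∷ps⊆W′) = absorb tw ps b∈W walk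
    in  W′ , tw′ , W⊆W′ , ∈-∷⁺ʳ (W⊆W′ a∈W) b∷ps⊆W′
  ... | no b∉W =
    let (W′ , tw′ , W⊆W′ , b∷ps⊆W′) =
          absorb (detour-twiceOrNever ab a∈W b∉W tw) ps (∈-detour W a∈W) walk
    in  W′ , tw′ , ⊆-trans (⊆-detour W) W⊆W′ , ∈-∷⁺ʳ (W⊆W′ (⊆-detour W a∈W)) b∷ps⊆W′

  ∈-walkFromTo : ∀ {u v} w → WalkFromTo G u v w → v ∈ w
  ∈-walkFromTo (a ∷ [])    (_ , refl , _)    = here refl
  ∈-walkFromTo (a ∷ b ∷ w) (_ , last , _ , walk) = there (∈-walkFromTo (b ∷ w) (refl , last , walk))

  private
    treeThrough : (∀ u v → ∃ (WalkFromTo G u v)) → ∀ r vs → ∃ λ W → TwiceOrNever W × (r ∷ vs) ⊆ W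
    treeThrough con r [] = r ∷ [] , (_ , λ _ _ → inj₁ refl) , ⊆-refl
    treeThrough con r (v ∷ vs) with treeThrough con r vs | con r v
    ... | W , tw , r∷vs⊆W | a ∷ ps , r⇝v@(refl , _ , walk) =
      let (W′ , tw′ , W⊆W′ , path⊆W′) = absorb tw ps (r∷vs⊆W (here refl)) walk
      in  W′ , tw′ , ∈-∷⁺ʳ (path⊆W′ (here refl)) (∈-∷⁺ʳ (path⊆W′ (∈-walkFromTo (a ∷ ps) r⇝v))
                                                        (λ x∈vs → W⊆W′ (r∷vs⊆W (there x∈vs))))

  spanningTree : Connected G → ∃ λ W → TwiceOrNever W × ∀ v → v ∈ W
  spanningTree (N≥1 , con) =
    let (W , tw , r∷all⊆W) = treeThrough con (fromℕ< N≥1) (allFin N)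
    in  W , tw , λ v → r∷all⊆W (there (∈-allFin v))

  -- Prescribed traversal counts

  Spanning : List (Fin N) → Set
  Spanning W = IsWalk G W × (∀ v → v ∈ W)

  record Achievable (F : Fin N → Fin N → ℕ) : Set where
    constructor achievable
    field
      extend : ∀ {W} → Spanning W →
               ∃ λ W′ → Spanning W′ × ∀ x y → trav G W′ x y ≡ 2 * F x y + trav G W x y
  open Achievable

  achievable-zero : ∀ {F} → (∀ x y → F x y ≡ 0) → Achievable F
  achievable-zero F≡0 = achievable λ {W} spans →
    W , spans , λ x y → cong (λ f → 2 * f + trav G W x y) (sym (F≡0 x y))

  achievable-+ : ∀ {F H} → Achievable F → Achievable H → Achievable (λ x y → F x y + H x y)
  achievable-+ {F} {H} F-ach H-ach = achievable λ {W} spans →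
    let (W₁ , spans₁ , trav₁) = extend F-ach spans
        (W₂ , spans₂ , trav₂) = extend H-ach spans₁
    in  W₂ , spans₂ , λ x y → begin
      trav G W₂ x y                            ≡⟨ trav₂ x y ⟩
      2 * H x y + trav G W₁ x y                ≡⟨ cong (2 * H x y +_) (trav₁ x y) ⟩
      2 * H x y + (2 * F x y + trav G W x y)   ≡⟨ x∙yz≈y∙xz (2 * H x y) (2 * F x y) _ ⟩
      2 * F x y + (2 * H x y + trav G W x y)   ≡⟨ +-assoc (2 * F x y) (2 * H x y) _ ⟨
      2 * F x y + 2 * H x y + trav G W x y     ≡⟨ cong (_+ trav G W x y) (*-distribˡ-+ 2 (F x y) _) ⟨
      2 * (F x y + H x y) + trav G W x y       ∎
    where open ≡-Reasoning

  achievable-* : ∀ {F} → Achievable F → ∀ k → Achievable (λ x y → k * F x y)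
  achievable-* F-ach zero    = achievable-zero (λ _ _ → refl)
  achievable-* F-ach (suc k) = achievable-+ F-ach (achievable-* F-ach k)

  achievable-Σ : ∀ m {F : Fin m → Fin N → Fin N → ℕ} → (∀ i → Achievable (F i)) →
                 Achievable (λ x y → Σ[ m ] (λ i → F i x y))
  achievable-Σ zero    F-ach = achievable-zero (λ _ _ → refl)
  achievable-Σ (suc m) F-ach = achievable-+ (F-ach zero) (achievable-Σ m (F-ach ∘ suc))

  achievable-δ : ∀ {u v} → A u v ≡ true → Achievable (δ u v)
  achievable-δ {u} {v} uv = achievable λ {W} (walk , all∈W) →
    detour u v W , (detour-walk W uv (all∈W u) walk , ⊆-detour W ∘ all∈W) ,
    trav-detour v W (all∈W u)

  achievable-guarded : ∀ b {u v} → (b ≡ true → A u v ≡ true) →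
                       ∀ k → Achievable (λ x y → (if b then k else 0) * δ u v x y)
  achievable-guarded true  uv k = achievable-* (achievable-δ (uv refl)) k
  achievable-guarded false uv k = achievable-zero (λ _ _ → refl)

  Traverses : List (Fin N) → (Fin N → Fin N → ℕ) → Set
  Traverses W g = ∀ x y → A x y ≡ true → trav G W x y ≡ g x y

  private
    module Completion {f : Fin N → Fin N → ℕ} (f-lab : IsLabelling G f) (B : List (Fin N))
                      (B-trav : ∀ x y → trav G B x y ≡ 0 ⊎ trav G B x y ≡ 2) where

      -- B traverses xy some t ∈ {0, 2} times; the remaining 2 · (f x y ∸ t / 2) traversals are
      -- added as detours, counted on the orientation x < y only.
      missing : Fin N → Fin N → ℕ
      missing u v = f u v ∸ trav G B u v / 2

      detours : Fin N → Fin N → ℕ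
      detours u v = if oriented u v then missing u v else 0

      added : Fin N → Fin N → ℕ
      added x y = Σ[ N ] (λ u → Σ[ N ] (λ v → detours u v * δ u v x y))

      added-achievable : Achievable added
      added-achievable = achievable-Σ N (λ u → achievable-Σ N (λ v →
        achievable-guarded (oriented u v) (∧-trueˡ (A u v)) (missing u v)))

      added-on-edge : ∀ {x y} → A x y ≡ true → added x y ≡ missing x y
      added-on-edge {x} {y} xy = begin
        added x y
          ≡⟨ Σ-cong N (λ u → Σ-cong N (λ v → cong (detours u v *_) (δ-comm u v x y))) ⟩
        Σ[ N ] (λ u → Σ[ N ] (λ v → detours u v * δ x y u v))
          ≡⟨ Σ²-δ N detours (adj⇒≢ xy) ⟩
        detours x y + detours y x
          ≡⟨ cong (λ m → detours x y + (if oriented y x then m else 0)) missing-sym ⟩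
        (if oriented x y then missing x y else 0) + (if oriented y x then missing x y else 0)
          ≡⟨ oriented-pair xy (missing x y) ⟩
        missing x y
          ∎
        where
        open ≡-Reasoning
        missing-sym : missing y x ≡ missing x y
        missing-sym = cong₂ (λ a t → a ∸ t / 2) (sym (proj₂ (f-lab x y xy))) (trav-sym B y x)

      completes : ∀ {x y} → A x y ≡ true → 2 * added x y + trav G B x y ≡ 2 * f x y
      completes {x} {y} xy = trans (cong (λ d → 2 * d + trav G B x y) (added-on-edge xy))
                                   (2[m∸t/2]+t≡2m (proj₁ (f-lab x y xy)) (B-trav x y))

  labelling⇒walk : Connected G → ∀ {f} → IsLabelling G f →
                   ∃ λ W → IsWalk G W × Traverses W (λ x y → 2 * f x y)
  labelling⇒walk con f-lab =
    let (B , (B-walk , B-trav) , B-spans) = spanningTree con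
        open Completion f-lab B B-trav
        (W , (W-walk , _) , W-trav) = extend added-achievable (B-walk , B-spans)
    in  W , W-walk , λ x y xy → trans (W-trav x y) (completes xy)

  -- Labellings from walks and walks from labellings

  traversalLabelling : List (Fin N) → Fin N → Fin N → ℕ
  traversalLabelling w u v = suc (trav G w u v)

  traversalLabelling-isLabelling : ∀ w → IsLabelling G (traversalLabelling w)
  traversalLabelling-isLabelling w u v _ = s≤s z≤n , cong suc (trav-sym w u v)

  σ-traversalLabelling : ∀ w u → σ G (traversalLabelling w) u ≡ degPlus G w u
  σ-traversalLabelling w u = trans (Σ-cong N (λ v → if-suc (A u v) _)) (Σ-distrib-+ N _ _)

  irregularising⇒proper : ∀ {w} → IsIrregularising G w → IsProper G (traversalLabelling w)
  irregularising⇒proper {w} (_ , irregular) u v uv σu≡σv =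
    irregular u v uv
      (trans (sym (σ-traversalLabelling w u)) (trans σu≡σv (σ-traversalLabelling w v)))

  labelSum-traversalLabelling : ∀ {w} → IsWalk G w →
                                labelSum G (traversalLabelling w) ≡ edges G + walkLength G w
  labelSum-traversalLabelling {w} walk = begin
    labelSum G (traversalLabelling w)
      ≡⟨ Σ-cong N (λ u → Σ-cong N (λ v → if-suc (oriented u v) _)) ⟩
    Σ[ N ] (λ u → Σ[ N ] (λ v → [ oriented u v ] + (if oriented u v then trav G w u v else 0)))
      ≡⟨ Σ²-distrib-+ N _ _ ⟩
    edges G + totalTrav w
      ≡⟨ cong (edges G +_) (walkLength≡totalTrav w walk) ⟨
    edges G + walkLength G w
      ∎
    where open ≡-Reasoning

  trav≤maxEdgeTrav : ∀ w {u v} → A u v ≡ true → trav G w u v ≤ maxEdgeTrav G w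
  trav≤maxEdgeTrav w {u} {v} uv = begin
    trav G w u v                                          ≡⟨ cong (λ b → if b then trav G w u v else 0) uv ⟨
    (if A u v then trav G w u v else 0)                   ≤⟨ term≤Max N _ v ⟩
    Max[ N ] (λ v → if A u v then trav G w u v else 0)    ≤⟨ term≤Max N _ u ⟩
    maxEdgeTrav G w                                       ∎
    where open ≤-Reasoning

  trav≤maxVertexTrav : ∀ w {u v} → A u v ≡ true → trav G w u v ≤ maxVertexTrav G w
  trav≤maxVertexTrav w {u} {v} uv = begin
    trav G w u v                                          ≡⟨ cong (λ b → if b then trav G w u v else 0) uv ⟨
    (if A u v then trav G w u v else 0)                   ≤⟨ term≤Σ N _ v ⟩
    incident G w u                                        ≤⟨ term≤Max N _ u ⟩
    maxVertexTrav G w                                     ∎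
    where open ≤-Reasoning

  vertexSum-traversalLabelling : ∀ w → vertexSum G (traversalLabelling w) ≤ Δ G + maxVertexTrav G w
  vertexSum-traversalLabelling w = Max-lub N _ λ u →
    subst (_≤ Δ G + maxVertexTrav G w) (sym (σ-traversalLabelling w u))
          (+-mono-≤ (term≤Max N (deg G) u) (term≤Max N (incident G w) u))

  module _ (W : List (Fin N)) (k : ℕ) {ℓ : Fin N → Fin N → ℕ}
           (W-trav : Traverses W (λ x y → k * ℓ x y)) where

    incident-scaled : ∀ u → incident G W u ≡ k * σ G ℓ u
    incident-scaled u =
      trans (Σ-cong N (λ v → if-* (A u v) k (W-trav u v))) (sym (*-distribˡ-Σ N k _))

    totalTrav-scaled : totalTrav W ≡ k * labelSum G ℓ
    totalTrav-scaled = trans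
      (Σ-cong N (λ u → trans (Σ-cong N (λ v → if-* (oriented u v) k (W-trav u v ∘ ∧-trueˡ (A u v))))
                             (sym (*-distribˡ-Σ N k _))))
      (sym (*-distribˡ-Σ N k _))

    maxEdgeTrav-scaled : ∀ {K} → (∀ u v → A u v ≡ true → ℓ u v ≤ K) → maxEdgeTrav G W ≤ k * K
    maxEdgeTrav-scaled ℓ≤K = Max-lub N _ λ u → Max-lub N _ λ v → if-≤ (A u v) λ uv →
      ≤-trans (≤-reflexive (W-trav u v uv)) (*-monoʳ-≤ k (ℓ≤K u v uv))

    maxVertexTrav-scaled : maxVertexTrav G W ≤ k * vertexSum G ℓ
    maxVertexTrav-scaled = Max-lub N _ λ u →
      subst (_≤ k * vertexSum G ℓ) (sym (incident-scaled u)) (*-monoʳ-≤ k (term≤Max N (σ G ℓ) u))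

    proper⇒irregular : IsProper G ℓ → (∀ {u v} → A u v ≡ true → deg G u < k) →
                       ∀ u v → A u v ≡ true → degPlus G W u ≢ degPlus G W v
    proper⇒irregular proper deg<k u v uv eq = proper u v uv
      (quotient-unique (deg<k uv) (deg<k (trans (adj-sym G v u) uv)) (begin
        deg G u + k * σ G ℓ u    ≡⟨ cong (deg G u +_) (incident-scaled u) ⟨
        degPlus G W u            ≡⟨ eq ⟩
        degPlus G W v            ≡⟨ cong (deg G v +_) (incident-scaled v) ⟩
        deg G v + k * σ G ℓ v    ∎))
      where open ≡-Reasoning

  1≤Δ : ∀ {u v} → A u v ≡ true → 1 ≤ Δ G
  1≤Δ {u} {v} uv =
    ≤-trans (subst (λ b → [ b ] ≤ deg G u) uv (term≤Σ N (λ v → [ A u v ]) v)) (term≤Max N (deg G) u)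

  deg<2Δ : ∀ {u v} → A u v ≡ true → deg G u < 2 * Δ G
  deg<2Δ {u} uv = begin-strict
    deg G u          ≤⟨ term≤Max N (deg G) u ⟩
    Δ G              <⟨ m<m+n (Δ G) (≤-trans (1≤Δ uv) (m≤m+n (Δ G) 0)) ⟩
    Δ G + (Δ G + 0)  ≡⟨⟩
    2 * Δ G          ∎
    where open ≤-Reasoning

  proper⇒irregularisingWalk : Connected G → ∀ {ℓ} → IsLabelling G ℓ → IsProper G ℓ →
                              ∃ λ W → IsIrregularising G W × Traverses W (λ x y → 2 * Δ G * ℓ x y)
  proper⇒irregularisingWalk con {ℓ} lab proper =
    let (W , W-walk , W-trav) = labelling⇒walk con Δℓ-lab
        W-trav′ = reassoc W W-trav
    in  W , (W-walk , proper⇒irregular W (2 * Δ G) W-trav′ proper deg<2Δ) , W-trav′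
    where
    Δℓ-lab : IsLabelling G (λ u v → Δ G * ℓ u v)
    Δℓ-lab u v uv = *-mono-≤ (1≤Δ uv) (proj₁ (lab u v uv)) , cong (Δ G *_) (proj₂ (lab u v uv))

    reassoc : ∀ W → Traverses W (λ x y → 2 * (Δ G * ℓ x y)) → Traverses W (λ x y → 2 * Δ G * ℓ x y)
    reassoc W W-trav x y xy = trans (W-trav x y xy) (sym (*-assoc 2 (Δ G) (ℓ x y)))

  -- Minimal irregularising walks

  IsWalk? : ∀ w → Dec (IsWalk G w)
  IsWalk? []          = yes _
  IsWalk? (a ∷ [])    = yes _
  IsWalk? (a ∷ b ∷ w) = (A a b Bool.≟ true) ×-dec IsWalk? (b ∷ w)

  IsIrregularising? : ∀ w → Dec (IsIrregularising G w)
  IsIrregularising? w = IsWalk? w ×-dec all? λ u → all? λ v →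
    (A u v Bool.≟ true) →-dec ¬? (degPlus G w u ≟ degPlus G w v)

  length≤1+walkLength : ∀ w → length w ≤ suc (walkLength G w)
  length≤1+walkLength []      = z≤n
  length≤1+walkLength (_ ∷ _) = ≤-refl

  IrregularisingWith : (List (Fin N) → ℕ) → ℕ → Set
  IrregularisingWith μ k = ∃ λ w → IsIrregularising G w × μ w ≡ k

  -- The bound on walk lengths in terms of μ makes the set of attained values decidable, so that
  -- its minimum can be found by search.
  minimum-irregularising : ∀ (μ : List (Fin N) → ℕ) (bound : ℕ → ℕ) →
                           (∀ w → IsIrregularising G w → walkLength G w ≤ bound (μ w)) →
                           ∀ {w} → IsIrregularising G w → ∃ (IsMin (IrregularisingWith μ))
  minimum-irregularising μ bound bounded {w} w-irr = minimum IrregularisingWith? (w , w-irr , refl)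
    where
    length≤ : ∀ {k} w → IsIrregularising G w → μ w ≡ k → length w ≤ suc (bound k)
    length≤ w w-irr refl = ≤-trans (length≤1+walkLength w) (s≤s (bounded w w-irr))

    IrregularisingWith? : Decidable (IrregularisingWith μ)
    IrregularisingWith? k = map′
      (λ (w , _ , w-irr , μw≡k) → w , w-irr , μw≡k)
      (λ (w , w-irr , μw≡k) → w , length≤ w w-irr μw≡k , w-irr , μw≡k)
      (∃-bounded? (λ w → IsIrregularising? w ×-dec (μ w ≟ k)) (suc (bound k)))

  walkLength≤ : ∀ {w} → IsWalk G w → walkLength G w ≤ N * (N * maxEdgeTrav G w)
  walkLength≤ {w} walk = begin
    walkLength G w
      ≡⟨ walkLength≡totalTrav w walk ⟩
    totalTrav w
      ≤⟨ Σ-mono-≤ N (λ u → Σ-mono-≤ N (λ v →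
           if-≤ (oriented u v) (trav≤maxEdgeTrav w ∘ ∧-trueˡ (A u v)))) ⟩
    Σ[ N ] (λ _ → Σ[ N ] (λ _ → maxEdgeTrav G w))
      ≡⟨ trans (Σ-cong N (λ _ → Σ-const N _)) (Σ-const N _) ⟩
    N * (N * maxEdgeTrav G w)
      ∎
    where open ≤-Reasoning

  maxEdgeTrav≤maxVertexTrav : ∀ w → maxEdgeTrav G w ≤ maxVertexTrav G w
  maxEdgeTrav≤maxVertexTrav w =
    Max-lub N _ λ u → Max-lub N _ λ v → if-≤ (A u v) (trav≤maxVertexTrav w)

  MLW-exists : ∀ {w} → IsIrregularising G w → ∃ (IsMLW G)
  MLW-exists = minimum-irregularising (walkLength G) id (λ _ _ → ≤-refl)

  MEW-exists : ∀ {w} → IsIrregularising G w → ∃ (IsMEW G)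
  MEW-exists = minimum-irregularising (maxEdgeTrav G) (λ k → N * (N * k)) λ _ (walk , _) →
    walkLength≤ walk

  MVW-exists : ∀ {w} → IsIrregularising G w → ∃ (IsMVW G)
  MVW-exists = minimum-irregularising (maxVertexTrav G) (λ k → N * (N * k)) λ w (walk , _) →
    ≤-trans (walkLength≤ walk) (*-monoʳ-≤ N (*-monoʳ-≤ N (maxEdgeTrav≤maxVertexTrav w)))


  MLW-bounds : Connected G → ∀ x → IsMinLabelSum G x →
               ∃ λ L → IsMLW G L × x ≤ L + edges G × L + edges G ≤ 3 * (edges G + Δ G * x)
  MLW-bounds con x ((ℓ , lab , proper , refl) , x-least)
    with W , W-irr , W-trav ← proper⇒irregularisingWalk con lab proper
    with L , L-min@((w , w-irr@(w-walk , _) , refl) , L-least) ← MLW-exists W-irr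
    = L , L-min , x≤L+m , L+m≤
    where
    w-proper : IsProper G (traversalLabelling w)
    w-proper = irregularising⇒proper w-irr

    x≤L+m : x ≤ L + edges G
    x≤L+m = begin
      x                                   ≤⟨ x-least _ (_ , traversalLabelling-isLabelling w , w-proper , refl) ⟩
      labelSum G (traversalLabelling w)   ≡⟨ labelSum-traversalLabelling w-walk ⟩
      edges G + L                         ≡⟨ +-comm (edges G) L ⟩
      L + edges G                         ∎
      where open ≤-Reasoning

    L+m≤ : L + edges G ≤ 3 * (edges G + Δ G * x)
    L+m≤ = m≤2n⇒m+o≤3[o+n] (edges G) (begin
      L                       ≤⟨ L-least _ (W , W-irr , refl) ⟩
      walkLength G W          ≡⟨ walkLength≡totalTrav W (proj₁ W-irr) ⟩
      totalTrav W             ≡⟨ totalTrav-scaled W (2 * Δ G) W-trav ⟩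
      2 * Δ G * x             ≡⟨ *-assoc 2 (Δ G) x ⟩
      2 * (Δ G * x)           ∎)
      where open ≤-Reasoning

  MEW-bounds : Connected G → ∀ χ → IsChiS G χ →
               ∃ λ E → IsMEW G E × χ ≤ E + 1 × E + 1 ≤ 3 * (1 + Δ G * χ)
  MEW-bounds con χ ((ℓ , (lab , ℓ≤χ) , proper) , χ-least)
    with W , W-irr , W-trav ← proper⇒irregularisingWalk con lab proper
    with E , E-min@((w , w-irr , refl) , E-least) ← MEW-exists W-irr
    = E , E-min , χ≤E+1 , E+1≤
    where
    label≤E+1 : ∀ u v → A u v ≡ true → traversalLabelling w u v ≤ E + 1
    label≤E+1 u v uv =
      subst (traversalLabelling w u v ≤_) (+-comm 1 E) (s≤s (trav≤maxEdgeTrav w uv))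

    χ≤E+1 : χ ≤ E + 1
    χ≤E+1 = χ-least _
      (_ , (traversalLabelling-isLabelling w , label≤E+1) , irregularising⇒proper w-irr)

    E+1≤ : E + 1 ≤ 3 * (1 + Δ G * χ)
    E+1≤ = m≤2n⇒m+o≤3[o+n] 1 (begin
      E                  ≤⟨ E-least _ (W , W-irr , refl) ⟩
      maxEdgeTrav G W    ≤⟨ maxEdgeTrav-scaled W (2 * Δ G) W-trav ℓ≤χ ⟩
      2 * Δ G * χ        ≡⟨ *-assoc 2 (Δ G) χ ⟩
      2 * (Δ G * χ)      ∎)
      where open ≤-Reasoning

  MVW-bounds : Connected G → ∀ x → IsMinVertexSum G x →
               ∃ λ V → IsMVW G V × x ≤ V + Δ G × V + Δ G ≤ 3 * Δ G * (1 + x)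
  MVW-bounds con x ((ℓ , lab , proper , refl) , x-least)
    with W , W-irr , W-trav ← proper⇒irregularisingWalk con lab proper
    with V , V-min@((w , w-irr , refl) , V-least) ← MVW-exists W-irr
    = V , V-min , x≤V+Δ , V+Δ≤
    where
    w-proper : IsProper G (traversalLabelling w)
    w-proper = irregularising⇒proper w-irr

    x≤V+Δ : x ≤ V + Δ G
    x≤V+Δ = begin
      x                                    ≤⟨ x-least _ (_ , traversalLabelling-isLabelling w , w-proper , refl) ⟩
      vertexSum G (traversalLabelling w)   ≤⟨ vertexSum-traversalLabelling w ⟩
      Δ G + V                              ≡⟨ +-comm (Δ G) V ⟩
      V + Δ G                              ∎
      where open ≤-Reasoning

    V+Δ≤ : V + Δ G ≤ 3 * Δ G * (1 + x)
    V+Δ≤ = begin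
      V + Δ G                  ≤⟨ m≤2n⇒m+o≤3[o+n] (Δ G) (begin
          V                        ≤⟨ V-least _ (W , W-irr , refl) ⟩
          maxVertexTrav G W        ≤⟨ maxVertexTrav-scaled W (2 * Δ G) W-trav ⟩
          2 * Δ G * x              ≡⟨ *-assoc 2 (Δ G) x ⟩
          2 * (Δ G * x)            ∎) ⟩
      3 * (Δ G + Δ G * x)      ≡⟨ cong (λ d → 3 * (d + Δ G * x)) (*-identityʳ (Δ G)) ⟨
      3 * (Δ G * 1 + Δ G * x)  ≡⟨ cong (3 *_) (*-distribˡ-+ (Δ G) 1 x) ⟨
      3 * (Δ G * (1 + x))      ≡⟨ *-assoc 3 (Δ G) (1 + x) ⟨
      3 * Δ G * (1 + x)        ∎
      where open ≤-Reasoning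

theorem4p3 : (G : Graph) → Nice G →
      (∀ x → IsMinLabelSum G x →
        ∃ λ L → IsMLW G L × x ≤ L + edges G × L + edges G ≤ 3 * (edges G + Δ G * x))
    × (∀ χ → IsChiS G χ →
        ∃ λ E → IsMEW G E × χ ≤ E + 1 × E + 1 ≤ 3 * (1 + Δ G * χ))
    × (∀ x → IsMinVertexSum G x →
        ∃ λ V → IsMVW G V × x ≤ V + Δ G × V + Δ G ≤ 3 * Δ G * (1 + x))
theorem4p3 G (connected , _) =
  MLW-bounds G connected , MEW-bounds G connected , MVW-bounds G connected
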